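{- Let $0<q<1$ and $\lambda\in\mathbb{C}$ with $\lambda\neq 1$. For every integer $n\ge 0$, $$B_{n,q}(x)=\frac{1}{1-\lambda}\sum_{k=0}^{n}\binom{n}{k}_q\Big\{B_{n-k,q}(1)-\lambda B_{n-k,q}\Big\}H_{k,q}(x\mid\lambda).$$
   Context: For a number $x$, $[x]_q=\frac{1-q^{x}}{1-q}$; $[0]_q!=1$ and $[n]_q!=[n]_q\cdots[1]_q$; $\binom{n}{k}_q=\frac{[n]_q!}{[k]_q![n-k]_q!}$. The $q$-exponential is $e_q(z)=\sum_{n\ge0}\frac{z^n}{[n]_q!}$. The $q$-Bernoulli polynomials (of Hegazi–Mansour) are defined by $\frac{t}{e_q(t)-1}e_q(xt)=\sum_{n\ge0}B_{n,q}(x)\frac{t^n}{[n]_q!}$, and $B_{n,q}:=B_{n,q}(0)$. The $q$-Frobenius–Euler polynomials $H_{n,q}(x\mid\lambda)$ are defined by $\frac{1-\lambda}{e_q(t)-\lambda}e_q(xt)=\sum_{n\ge0}H_{n,q}(x\mid\lambda)\frac{t^n}{[n]_q!}$; all generating functions are formal power series in $t$. -}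

module Defs where

open import Level using (_⊔_)
open import Data.Nat using (ℕ; zero; suc; _∸_)
open import Relation.Nullary using (¬_)
open import Algebra.Bundles using (CommutativeRing)

-- A field: a commutative ring with 1 ≠ 0 and a (total) inversion
-- operation which is a genuine inverse on nonzero elements
-- (the value of 0⁻¹ is irrelevant).
record Field c ℓ : Set (Level.suc (c ⊔ ℓ)) where
  field
    commutativeRing : CommutativeRing c ℓ
  open CommutativeRing commutativeRing public
  field
    _⁻¹        : Carrier → Carrier
    inverseʳ   : ∀ x → ¬ (x ≈ 0#) → (x * (x ⁻¹)) ≈ 1#
    nontrivial : ¬ (1# ≈ 0#)

module _ {c ℓ} (F : Field c ℓ) where
  open Field F

  infixr 8 _^_
  _^_ : Carrier → ℕ → Carrier
  x ^ zero  = 1#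
  x ^ suc n = x * (x ^ n)

  sumTo : ℕ → (ℕ → Carrier) → Carrier
  sumTo zero    f = f 0
  sumTo (suc n) f = sumTo n f + f (suc n)

  qnum : Carrier → ℕ → Carrier
  qnum q n = (1# - (q ^ n)) * ((1# - q) ⁻¹)

  qfact : Carrier → ℕ → Carrier
  qfact q zero    = 1#
  qfact q (suc n) = qnum q (suc n) * qfact q n

  qbinom : Carrier → ℕ → ℕ → Carrier
  qbinom q n k = qfact q n * ((qfact q k * qfact q (n ∸ k)) ⁻¹)

  PowerSeries : Set c
  PowerSeries = ℕ → Carrier

  _·ₛ_ : PowerSeries → PowerSeries → PowerSeries
  (f ·ₛ g) n = sumTo n (λ k → f k * g (n ∸ k))

  _≈ₛ_ : PowerSeries → PowerSeries → Set ℓ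
  f ≈ₛ g = ∀ n → f n ≈ g n

  tₛ : PowerSeries
  tₛ zero          = 0#
  tₛ (suc zero)    = 1#
  tₛ (suc (suc n)) = 0#

  constₛ : Carrier → PowerSeries
  constₛ a zero    = a
  constₛ a (suc n) = 0#

  _-ₛ_ : PowerSeries → PowerSeries → PowerSeries
  (f -ₛ g) n = f n - g n

  -- e_q(z t) = Σ z^n t^n / [n]_q!
  eq : Carrier → Carrier → PowerSeries
  eq q z n = (z ^ n) * (qfact q n ⁻¹)

  qEGF : Carrier → (ℕ → Carrier) → PowerSeries
  qEGF q a n = a n * (qfact q n ⁻¹)

  -- B is the family of q-Bernoulli polynomials (Hegazi–Mansour):
  --   t/(e_q(t)-1) e_q(xt) = Σ B n x t^n/[n]_q!  for every x,
  -- stated (equivalently, since e_q(t)-1 = t·unit) with the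
  -- denominator cleared:  (e_q(t)-1)·Σ B_{n,q}(x) t^n/[n]_q! = t·e_q(xt).
  IsQBernoulli : Carrier → (Carrier → ℕ → Carrier) → Set (c ⊔ ℓ)
  IsQBernoulli q B = ∀ x →
    ((eq q 1# -ₛ constₛ 1#) ·ₛ qEGF q (B x)) ≈ₛ (tₛ ·ₛ eq q x)

  -- H is the family of q-Frobenius–Euler polynomials H_{n,q}(x|λ):
  --   (1-λ)/(e_q(t)-λ) e_q(xt) = Σ H_{n,q}(x|λ) t^n/[n]_q!,
  -- with denominator cleared (e_q(t)-λ is invertible since λ ≠ 1).
  IsQFrobeniusEuler : Carrier → Carrier → (Carrier → ℕ → Carrier) → Set (c ⊔ ℓ)
  IsQFrobeniusEuler q lam H = ∀ x →
    ((eq q 1# -ₛ constₛ lam) ·ₛ qEGF q (H x)) ≈ₛ (constₛ (1# - lam) ·ₛ eq q x)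

-- Write D(t) = e_q(t) - 1 and C(t) = Σ (B_{n,q}(1) - λ B_{n,q}) tⁿ/[n]_q!.  The defining
-- relations give D·C = t·(e_q(t) - λ) (using e_q(0·t) = 1), and then
--   D · (C · Σ H_{n,q}(x|λ) tⁿ/[n]_q!) = t·(1-λ)·e_q(xt) = D · ((1-λ)·Σ B_{n,q}(x) tⁿ/[n]_q!).
-- Since D has zero constant term and nonzero linear term, D can be cancelled; comparing
-- coefficients, the product of the two q-exponential generating functions is the
-- q-binomial convolution, and dividing by 1 - λ gives the theorem.
module Submission where

open import Defs
open import Data.Nat using (ℕ; zero; suc; _∸_; _≤_; _<_; z≤n; s≤s)
open import Data.Nat.Properties
  using (n∸n≡0; m+n∸n≡m; +-∸-assoc; m∸[m∸n]≡n; ≤-refl; m≤n⇒m≤1+n; m≤n⇒m<n∨m≡n)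
open import Data.Sum using (inj₁; inj₂)
open import Relation.Nullary using (¬_)
open import Relation.Binary.Bundles using (Setoid)
open import Relation.Binary.PropositionalEquality as ≡ using (_≡_)
import Algebra.Properties.Ring as RingProperties
import Algebra.Properties.Group as GroupProperties
import Algebra.Properties.AbelianGroup as AbelianGroupProperties
import Algebra.Solver.Ring.NaturalCoefficients.Default as Solver
import Relation.Binary.Reasoning.Setoid as SetoidReasoning

module _ {c ℓ} (F : Field c ℓ) where
  open Field F
  open Solver commutativeSemiring using (solve; _:+_; _:*_; _:=_)
  private
    module R = RingProperties ring
    module G = GroupProperties +-group
    module A = AbelianGroupProperties +-abelianGroup

  infixl 7 _⊛_
  infixl 6 _⊖_
  infix 4 _≋_

  _⊛_ : PowerSeries F → PowerSeries F → PowerSeries F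
  _⊛_ = _·ₛ_ F

  _⊖_ : PowerSeries F → PowerSeries F → PowerSeries F
  _⊖_ = _-ₛ_ F

  _≋_ : PowerSeries F → PowerSeries F → Set ℓ
  _≋_ = _≈ₛ_ F

  0ₛ : PowerSeries F
  0ₛ _ = 0#

  seriesSetoid : Setoid c ℓ
  seriesSetoid = record
    { Carrier       = PowerSeries F
    ; _≈_           = _≋_
    ; isEquivalence = record
      { refl  = λ _ → refl
      ; sym   = λ f≋g n → sym (f≋g n)
      ; trans = λ f≋g g≋h n → trans (f≋g n) (g≋h n)
      }
    }

  module _ where
    open SetoidReasoning setoid

    sumTo-cong : ∀ n {f g : ℕ → Carrier} → (∀ k → k ≤ n → f k ≈ g k) →
                 sumTo F n f ≈ sumTo F n g
    sumTo-cong zero    f≈g = f≈g 0 z≤n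
    sumTo-cong (suc n) f≈g =
      +-cong (sumTo-cong n (λ k k≤n → f≈g k (m≤n⇒m≤1+n k≤n))) (f≈g (suc n) ≤-refl)

    sumTo-cong′ : ∀ n {f g : ℕ → Carrier} → (∀ k → f k ≈ g k) → sumTo F n f ≈ sumTo F n g
    sumTo-cong′ n f≈g = sumTo-cong n (λ k _ → f≈g k)

    sumTo-+ : ∀ n (f g : ℕ → Carrier) →
              sumTo F n (λ k → f k + g k) ≈ sumTo F n f + sumTo F n g
    sumTo-+ zero    f g = refl
    sumTo-+ (suc n) f g = trans (+-cong (sumTo-+ n f g) refl)
      (solve 4 (λ a b c d → (a :+ b) :+ (c :+ d) := (a :+ c) :+ (b :+ d)) refl _ _ _ _)

    sumTo-distribˡ : ∀ n a (f : ℕ → Carrier) → a * sumTo F n f ≈ sumTo F n (λ k → a * f k)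
    sumTo-distribˡ zero    a f = refl
    sumTo-distribˡ (suc n) a f = trans (distribˡ a _ _) (+-cong (sumTo-distribˡ n a f) refl)

    sumTo-distribʳ : ∀ n a (f : ℕ → Carrier) → sumTo F n f * a ≈ sumTo F n (λ k → f k * a)
    sumTo-distribʳ zero    a f = refl
    sumTo-distribʳ (suc n) a f = trans (distribʳ a _ _) (+-cong (sumTo-distribʳ n a f) refl)

    sumTo-neg : ∀ n (f : ℕ → Carrier) → - sumTo F n f ≈ sumTo F n (λ k → - f k)
    sumTo-neg zero    f = refl
    sumTo-neg (suc n) f = trans (sym (A.⁻¹-∙-comm _ _)) (+-cong (sumTo-neg n f) refl)

    sumTo-- : ∀ n (f g : ℕ → Carrier) →
              sumTo F n (λ k → f k - g k) ≈ sumTo F n f - sumTo F n g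
    sumTo-- n f g = trans (sumTo-+ n f (λ k → - g k)) (+-cong refl (sym (sumTo-neg n g)))

    sumTo-sucˡ : ∀ n (f : ℕ → Carrier) → sumTo F (suc n) f ≈ f 0 + sumTo F n (λ k → f (suc k))
    sumTo-sucˡ zero    f = refl
    sumTo-sucˡ (suc n) f = trans (+-cong (sumTo-sucˡ n f) refl) (+-assoc _ _ _)

    sumTo-reverse : ∀ n (f : ℕ → Carrier) → sumTo F n f ≈ sumTo F n (λ k → f (n ∸ k))
    sumTo-reverse zero    f = refl
    sumTo-reverse (suc n) f = sym (begin
      sumTo F (suc n) (λ k → f (suc n ∸ k)) ≈⟨ sumTo-sucˡ n (λ k → f (suc n ∸ k)) ⟩
      f (suc n) + sumTo F n (λ k → f (n ∸ k)) ≈⟨ +-cong refl (sym (sumTo-reverse n f)) ⟩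
      f (suc n) + sumTo F n f                 ≈⟨ +-comm _ _ ⟩
      sumTo F (suc n) f                       ∎)

    sumTo-zero : ∀ n (f : ℕ → Carrier) → (∀ k → k ≤ n → f k ≈ 0#) → sumTo F n f ≈ 0#
    sumTo-zero zero    f f≈0 = f≈0 0 z≤n
    sumTo-zero (suc n) f f≈0 = trans
      (+-cong (sumTo-zero n f (λ k k≤n → f≈0 k (m≤n⇒m≤1+n k≤n))) (f≈0 (suc n) ≤-refl))
      (+-identityʳ 0#)

    sumTo-last : ∀ n (f : ℕ → Carrier) → (∀ k → k < n → f k ≈ 0#) → sumTo F n f ≈ f n
    sumTo-last zero    f f≈0 = refl
    sumTo-last (suc n) f f≈0 =
      trans (+-cong (sumTo-zero n f (λ k k≤n → f≈0 k (s≤s k≤n))) refl) (+-identityˡ _)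

    sumTo-head : ∀ n (f : ℕ → Carrier) → (∀ k → f (suc k) ≈ 0#) → sumTo F n f ≈ f 0
    sumTo-head zero    f f≈0 = refl
    sumTo-head (suc n) f f≈0 = trans (+-cong (sumTo-head n f f≈0) (f≈0 n)) (+-identityʳ _)

    sumTo-triangle : ∀ n (h : ℕ → ℕ → ℕ → Carrier) →
      sumTo F n (λ k → sumTo F k (λ i → h i (k ∸ i) (n ∸ k))) ≈
      sumTo F n (λ i → sumTo F (n ∸ i) (λ j → h i j (n ∸ i ∸ j)))
    sumTo-triangle zero    h = refl
    sumTo-triangle (suc n) h =
      trans peel-left (trans (+-cong (sumTo-triangle n h′) refl) (sym peel-right))
      where
      h′ : ℕ → ℕ → ℕ → Carrier
      h′ i j l = h i j (suc l)


      suc∸ : ∀ m k → k ≤ m → suc m ∸ k ≡ suc (m ∸ k)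
      suc∸ m k k≤m = +-∸-assoc 1 k≤m

      diagonal : Carrier
      diagonal = sumTo F (suc n) (λ i → h i (suc n ∸ i) 0)

      peel-left : sumTo F (suc n) (λ k → sumTo F k (λ i → h i (k ∸ i) (suc n ∸ k))) ≈
                  sumTo F n (λ k → sumTo F k (λ i → h′ i (k ∸ i) (n ∸ k))) + diagonal
      peel-left = +-cong
        (sumTo-cong n (λ k k≤n → sumTo-cong′ k (λ i →
          reflexive (≡.cong (h i (k ∸ i)) (suc∸ n k k≤n)))))
        (sumTo-cong′ (suc n) (λ i → reflexive (≡.cong (h i (suc n ∸ i)) (n∸n≡0 n))))

      row : ∀ i → i ≤ n →
        sumTo F (suc n ∸ i) (λ j → h i j (suc n ∸ i ∸ j)) ≈
        sumTo F (n ∸ i) (λ j → h′ i j (n ∸ i ∸ j)) + h i (suc n ∸ i) 0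
      row i i≤n rewrite suc∸ n i i≤n = +-cong
        (sumTo-cong (n ∸ i) (λ j j≤ → reflexive (≡.cong (h i j) (suc∸ (n ∸ i) j j≤))))
        (reflexive (≡.cong (h i (suc (n ∸ i))) (n∸n≡0 (n ∸ i))))

      last-row : sumTo F (suc n ∸ suc n) (λ j → h (suc n) j (suc n ∸ suc n ∸ j)) ≈
                 h (suc n) (suc n ∸ suc n) 0
      last-row rewrite n∸n≡0 n = refl

      peel-right : sumTo F (suc n) (λ i → sumTo F (suc n ∸ i) (λ j → h i j (suc n ∸ i ∸ j))) ≈
                   sumTo F n (λ i → sumTo F (n ∸ i) (λ j → h′ i j (n ∸ i ∸ j))) + diagonal
      peel-right = trans (+-cong (trans (sumTo-cong n row) (sumTo-+ n _ _)) last-row)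
                         (+-assoc _ _ _)

    x*y≈1⇒y≈x⁻¹ : ∀ {x y} → ¬ x ≈ 0# → x * y ≈ 1# → y ≈ x ⁻¹
    x*y≈1⇒y≈x⁻¹ {x} {y} x≉0 xy≈1 = begin
      y                ≈⟨ sym (*-identityʳ y) ⟩
      y * 1#           ≈⟨ *-cong refl (sym (inverseʳ x x≉0)) ⟩
      y * (x * x ⁻¹)   ≈⟨ solve 3 (λ y x x′ → y :* (x :* x′) := (x :* y) :* x′) refl y x (x ⁻¹) ⟩
      (x * y) * x ⁻¹   ≈⟨ *-cong xy≈1 refl ⟩
      1# * x ⁻¹        ≈⟨ *-identityˡ _ ⟩
      x ⁻¹             ∎

    *-cancelʳ : ∀ {x y z} → ¬ z ≈ 0# → x * z ≈ y * z → x ≈ y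
    *-cancelʳ {x} {y} {z} z≉0 xz≈yz = trans (undo x) (trans (*-cong xz≈yz refl) (sym (undo y)))
      where
      undo : ∀ w → w ≈ (w * z) * z ⁻¹
      undo w = begin
        w                ≈⟨ sym (*-identityʳ w) ⟩
        w * 1#           ≈⟨ *-cong refl (sym (inverseʳ z z≉0)) ⟩
        w * (z * z ⁻¹)   ≈⟨ sym (*-assoc _ _ _) ⟩
        (w * z) * z ⁻¹   ∎

    *-preserves-≉0 : ∀ {x y} → ¬ x ≈ 0# → ¬ y ≈ 0# → ¬ x * y ≈ 0#
    *-preserves-≉0 x≉0 y≉0 xy≈0 = x≉0 (*-cancelʳ y≉0 (trans xy≈0 (sym (zeroˡ _))))

    ⁻¹-preserves-≉0 : ∀ {x} → ¬ x ≈ 0# → ¬ x ⁻¹ ≈ 0#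
    ⁻¹-preserves-≉0 {x} x≉0 x⁻¹≈0 =
      nontrivial (trans (sym (inverseʳ x x≉0)) (trans (*-cong refl x⁻¹≈0) (zeroʳ x)))

    ⁻¹-distrib-* : ∀ {x y} → ¬ x ≈ 0# → ¬ y ≈ 0# → (x * y) ⁻¹ ≈ x ⁻¹ * y ⁻¹
    ⁻¹-distrib-* {x} {y} x≉0 y≉0 = sym (x*y≈1⇒y≈x⁻¹ (*-preserves-≉0 x≉0 y≉0) (begin
      (x * y) * (x ⁻¹ * y ⁻¹)
        ≈⟨ solve 4 (λ a b c d → (a :* b) :* (c :* d) := (a :* c) :* (b :* d)) refl x y (x ⁻¹) (y ⁻¹) ⟩
      (x * x ⁻¹) * (y * y ⁻¹) ≈⟨ *-cong (inverseʳ x x≉0) (inverseʳ y y≉0) ⟩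
      1# * 1#                 ≈⟨ *-identityˡ _ ⟩
      1#                      ∎))

    x⁻¹*[x*y]≈y : ∀ {x} y → ¬ x ≈ 0# → x ⁻¹ * (x * y) ≈ y
    x⁻¹*[x*y]≈y {x} y x≉0 = begin
      x ⁻¹ * (x * y)   ≈⟨ solve 3 (λ x′ x y → x′ :* (x :* y) := (x :* x′) :* y) refl (x ⁻¹) x y ⟩
      (x * x ⁻¹) * y   ≈⟨ *-cong (inverseʳ x x≉0) refl ⟩
      1# * y           ≈⟨ *-identityˡ y ⟩
      y                ∎

    x-y≉0 : ∀ {x y} → ¬ x ≈ y → ¬ x - y ≈ 0#
    x-y≉0 {x} {y} x≉y x-y≈0 = x≉y (G.x∙y⁻¹≈ε⇒x≈y x y x-y≈0)

    ⊛-congˡ : ∀ {f g} h → f ≋ g → f ⊛ h ≋ g ⊛ h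
    ⊛-congˡ h f≋g n = sumTo-cong′ n (λ k → *-cong (f≋g k) refl)

    ⊛-congʳ : ∀ f {g h} → g ≋ h → f ⊛ g ≋ f ⊛ h
    ⊛-congʳ f g≋h n = sumTo-cong′ n (λ k → *-cong refl (g≋h (n ∸ k)))

    ⊖-cong : ∀ {f f′ g g′} → f ≋ f′ → g ≋ g′ → f ⊖ g ≋ f′ ⊖ g′
    ⊖-cong f≋f′ g≋g′ n = +-cong (f≋f′ n) (-‿cong (g≋g′ n))

    ⊖-congʳ : ∀ f {g g′} → g ≋ g′ → f ⊖ g ≋ f ⊖ g′
    ⊖-congʳ f = ⊖-cong {f} (λ _ → refl)

    ⊛-comm : ∀ f g → f ⊛ g ≋ g ⊛ f
    ⊛-comm f g n = trans (sumTo-reverse n _) (sumTo-cong n (λ k k≤n →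
      trans (*-comm _ _) (*-cong (reflexive (≡.cong g (m∸[m∸n]≡n k≤n))) refl)))

    ⊛-assoc : ∀ f g h → (f ⊛ g) ⊛ h ≋ f ⊛ (g ⊛ h)
    ⊛-assoc f g h n = begin
      ((f ⊛ g) ⊛ h) n
        ≈⟨ sumTo-cong′ n (λ k → sumTo-distribʳ k _ _) ⟩
      sumTo F n (λ k → sumTo F k (λ i → term i (k ∸ i) (n ∸ k)))
        ≈⟨ sumTo-triangle n term ⟩
      sumTo F n (λ i → sumTo F (n ∸ i) (λ j → term i j (n ∸ i ∸ j)))
        ≈⟨ sumTo-cong′ n (λ i → sym (trans (sumTo-distribˡ (n ∸ i) _ _)
                                           (sumTo-cong′ (n ∸ i) (λ j → sym (*-assoc _ _ _))))) ⟩
      (f ⊛ (g ⊛ h)) n ∎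
      where
      term : ℕ → ℕ → ℕ → Carrier
      term i j l = (f i * g j) * h l

    ⊛-distribˡ-⊖ : ∀ f g h → f ⊛ (g ⊖ h) ≋ f ⊛ g ⊖ f ⊛ h
    ⊛-distribˡ-⊖ f g h n = trans (sumTo-cong′ n (λ k → R.x[y-z]≈xy-xz _ _ _)) (sumTo-- n _ _)

    constₛ-⊛ : ∀ a f → constₛ F a ⊛ f ≋ (λ n → a * f n)
    constₛ-⊛ a f n = sumTo-head n _ (λ k → zeroˡ _)

    ⊛-identityʳ : ∀ f → f ⊛ constₛ F 1# ≋ f
    ⊛-identityʳ f n = trans (⊛-comm f (constₛ F 1#) n) (trans (constₛ-⊛ 1# f n) (*-identityˡ _))

    -- Strong induction: once h vanishes below n, coefficient n+1 of h ⊛ d is h n · d 1.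
    d⊛h≋0⇒h≋0 : ∀ d h → d 0 ≈ 0# → ¬ d 1 ≈ 0# → d ⊛ h ≋ 0ₛ → h ≋ 0ₛ
    d⊛h≋0⇒h≋0 d h d₀≈0 d₁≉0 d⊛h≋0 n = vanishes n (vanishes-below n)
      where
      vanishes : ∀ n → (∀ k → k < n → h k ≈ 0#) → h n ≈ 0#
      vanishes n below = *-cancelʳ d₁≉0 (begin
        h n * d 1
          ≈⟨ +-identityʳ _ ⟨
        h n * d 1 + 0#
          ≈⟨ +-cong (*-cong refl (reflexive (≡.cong d (m+n∸n≡m 1 n))))
                    (trans (*-cong refl (trans (reflexive (≡.cong d (n∸n≡0 n))) d₀≈0)) (zeroʳ _)) ⟨
        h n * d (suc n ∸ n) + h (suc n) * d (n ∸ n)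
          ≈⟨ +-cong (sumTo-last n _ (λ k k<n → trans (*-cong (below k k<n) refl) (zeroˡ _))) refl ⟨
        (h ⊛ d) (suc n)
          ≈⟨ trans (⊛-comm h d (suc n)) (d⊛h≋0 (suc n)) ⟩
        0#
          ≈⟨ zeroˡ _ ⟨
        0# * d 1 ∎)
      vanishes-below : ∀ n k → k < n → h k ≈ 0#
      vanishes-below (suc n) k (s≤s k≤n) with m≤n⇒m<n∨m≡n k≤n
      ... | inj₁ k<n    = vanishes-below n k k<n
      ... | inj₂ ≡.refl = vanishes k (vanishes-below k)

    ⊛-cancelˡ : ∀ d {f g} → d 0 ≈ 0# → ¬ d 1 ≈ 0# → d ⊛ f ≋ d ⊛ g → f ≋ g
    ⊛-cancelˡ d {f} {g} d₀≈0 d₁≉0 df≋dg n = G.x∙y⁻¹≈ε⇒x≈y _ _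
      (d⊛h≋0⇒h≋0 d (f ⊖ g) d₀≈0 d₁≉0
        (λ m → trans (⊛-distribˡ-⊖ d f g m) (trans (+-cong (df≋dg m) refl) (-‿inverseʳ _))) n)

  module _ where
    open SetoidReasoning seriesSetoid

    ⊛-leftComm : ∀ f g h → f ⊛ (g ⊛ h) ≋ g ⊛ (f ⊛ h)
    ⊛-leftComm f g h = begin
      f ⊛ (g ⊛ h)   ≈⟨ ⊛-assoc f g h ⟨
      (f ⊛ g) ⊛ h   ≈⟨ ⊛-congˡ h (⊛-comm f g) ⟩
      (g ⊛ f) ⊛ h   ≈⟨ ⊛-assoc g f h ⟩
      g ⊛ (f ⊛ h)   ∎

  module _ (q : Carrier) (q^suc≉1 : ∀ n → ¬ _^_ F q (suc n) ≈ 1#) where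
    private
      e : Carrier → PowerSeries F
      e = eq F q

      EGF : (ℕ → Carrier) → PowerSeries F
      EGF = qEGF F q

    qfact-≉0 : ∀ n → ¬ qfact F q n ≈ 0#
    qfact-≉0 zero    = nontrivial
    qfact-≉0 (suc n) = *-preserves-≉0
      (*-preserves-≉0 (x-y≉0 (λ 1≈q^ → q^suc≉1 n (sym 1≈q^)))
                      (⁻¹-preserves-≉0 (x-y≉0 (λ 1≈q → q^suc≉1 0 (trans (*-identityʳ q) (sym 1≈q))))))
      (qfact-≉0 n)

    module _ where
      open SetoidReasoning setoid

      qbinom-*-qfact⁻¹ : ∀ n k →
        qbinom F q n k * qfact F q n ⁻¹ ≈ qfact F q k ⁻¹ * qfact F q (n ∸ k) ⁻¹
      qbinom-*-qfact⁻¹ n k = begin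
        (qfact F q n * d ⁻¹) * qfact F q n ⁻¹
          ≈⟨ solve 3 (λ a b c → (a :* b) :* c := b :* (a :* c)) refl _ _ _ ⟩
        d ⁻¹ * (qfact F q n * qfact F q n ⁻¹) ≈⟨ *-cong refl (inverseʳ _ (qfact-≉0 n)) ⟩
        d ⁻¹ * 1#                             ≈⟨ *-identityʳ _ ⟩
        d ⁻¹                                  ≈⟨ ⁻¹-distrib-* (qfact-≉0 k) (qfact-≉0 (n ∸ k)) ⟩
        qfact F q k ⁻¹ * qfact F q (n ∸ k) ⁻¹ ∎
        where
        d = qfact F q k * qfact F q (n ∸ k)

      qEGF-qbinomConvolution : ∀ a b →
        EGF (λ n → sumTo F n (λ k → qbinom F q n k * (a (n ∸ k) * b k))) ≋ EGF b ⊛ EGF a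
      qEGF-qbinomConvolution a b n = trans (sumTo-distribʳ n _ _) (sumTo-cong′ n term)
        where
        term : ∀ k → (qbinom F q n k * (a (n ∸ k) * b k)) * qfact F q n ⁻¹ ≈ EGF b k * EGF a (n ∸ k)
        term k = begin
          (qbinom F q n k * (a (n ∸ k) * b k)) * qfact F q n ⁻¹
            ≈⟨ solve 3 (λ x y z → (x :* y) :* z := (x :* z) :* y) refl _ _ _ ⟩
          (qbinom F q n k * qfact F q n ⁻¹) * (a (n ∸ k) * b k)
            ≈⟨ *-cong (qbinom-*-qfact⁻¹ n k) refl ⟩
          (qfact F q k ⁻¹ * qfact F q (n ∸ k) ⁻¹) * (a (n ∸ k) * b k)
            ≈⟨ solve 4 (λ w x y z → (w :* x) :* (y :* z) := (z :* w) :* (y :* x)) refl _ _ _ _ ⟩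
          EGF b k * EGF a (n ∸ k) ∎

      qEGF-injective : ∀ {a b} → EGF a ≋ EGF b → ∀ n → a n ≈ b n
      qEGF-injective a≋b n = *-cancelʳ (⁻¹-preserves-≉0 (qfact-≉0 n)) (a≋b n)

      qEGF-scale : ∀ a b → EGF (λ n → a * b n) ≋ constₛ F a ⊛ EGF b
      qEGF-scale a b n = trans (*-assoc _ _ _) (sym (constₛ-⊛ a (EGF b) n))

      eq-zero : e 0# ≋ constₛ F 1#
      eq-zero zero    = inverseʳ 1# nontrivial
      eq-zero (suc n) = trans (*-cong (zeroˡ _) refl) (zeroˡ _)

      eq-one-linear-≉0 : ¬ (e 1# ⊖ constₛ F 1#) 1 ≈ 0#
      eq-one-linear-≉0 e₁≈0 = ⁻¹-preserves-≉0 (qfact-≉0 1) (begin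
        qfact F q 1 ⁻¹                   ≈⟨ *-identityˡ _ ⟨
        1# * qfact F q 1 ⁻¹              ≈⟨ *-cong (*-identityˡ 1#) refl ⟨
        (1# * 1#) * qfact F q 1 ⁻¹       ≈⟨ +-identityʳ _ ⟨
        (1# * 1#) * qfact F q 1 ⁻¹ + 0#  ≈⟨ +-cong refl G.ε⁻¹≈ε ⟨
        (e 1# ⊖ constₛ F 1#) 1           ≈⟨ e₁≈0 ⟩
        0#                               ∎)

    module _ (lam : Carrier)
             (B : Carrier → ℕ → Carrier) (isBernoulli : IsQBernoulli F q B)
             (H : Carrier → ℕ → Carrier) (isFrobeniusEuler : IsQFrobeniusEuler F q lam H)
             where
      open SetoidReasoning seriesSetoid

      private
        D : PowerSeries F
        D = e 1# ⊖ constₛ F 1#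

        t : PowerSeries F
        t = tₛ F

        cancel-D : ∀ {f g} → D ⊛ f ≋ D ⊛ g → f ≋ g
        cancel-D = ⊛-cancelˡ D (trans (+-cong (eq-zero 0) refl) (-‿inverseʳ 1#)) eq-one-linear-≉0

      bernoulliDifference : ℕ → Carrier
      bernoulliDifference m = B 1# m - lam * B 0# m

      qEGF-bernoulliDifference : EGF bernoulliDifference ≋ EGF (B 1#) ⊖ constₛ F lam ⊛ EGF (B 0#)
      qEGF-bernoulliDifference m =
        trans (R.[y-z]x≈yx-zx _ _ _) (+-cong refl (-‿cong (qEGF-scale lam (B 0#) m)))

      D⊛bernoulliDifference : D ⊛ EGF bernoulliDifference ≋ t ⊛ (e 1# ⊖ constₛ F lam)
      D⊛bernoulliDifference = begin
        D ⊛ EGF bernoulliDifference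
          ≈⟨ ⊛-congʳ D qEGF-bernoulliDifference ⟩
        D ⊛ (EGF (B 1#) ⊖ constₛ F lam ⊛ EGF (B 0#))
          ≈⟨ ⊛-distribˡ-⊖ D (EGF (B 1#)) (constₛ F lam ⊛ EGF (B 0#)) ⟩
        D ⊛ EGF (B 1#) ⊖ D ⊛ (constₛ F lam ⊛ EGF (B 0#))
          ≈⟨ ⊖-cong (isBernoulli 1#) (⊛-leftComm D (constₛ F lam) (EGF (B 0#))) ⟩
        t ⊛ e 1# ⊖ constₛ F lam ⊛ (D ⊛ EGF (B 0#))
          ≈⟨ ⊖-congʳ (t ⊛ e 1#) (⊛-congʳ (constₛ F lam) (isBernoulli 0#)) ⟩
        t ⊛ e 1# ⊖ constₛ F lam ⊛ (t ⊛ e 0#)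
          ≈⟨ ⊖-congʳ (t ⊛ e 1#) (⊛-congʳ (constₛ F lam) t⊛e0≋t) ⟩
        t ⊛ e 1# ⊖ constₛ F lam ⊛ t
          ≈⟨ ⊖-congʳ (t ⊛ e 1#) (⊛-comm (constₛ F lam) t) ⟩
        t ⊛ e 1# ⊖ t ⊛ constₛ F lam
          ≈⟨ ⊛-distribˡ-⊖ t (e 1#) (constₛ F lam) ⟨
        t ⊛ (e 1# ⊖ constₛ F lam) ∎
        where
        t⊛e0≋t : t ⊛ e 0# ≋ t
        t⊛e0≋t m = trans (⊛-congʳ t eq-zero m) (⊛-identityʳ t m)

      qEGF-bernoulli-frobeniusEuler : ∀ x →
        EGF (λ n → sumTo F n (λ k → qbinom F q n k * (bernoulliDifference (n ∸ k) * H x k)))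
          ≋ constₛ F (1# - lam) ⊛ EGF (B x)
      qEGF-bernoulli-frobeniusEuler x = begin
        EGF (λ n → sumTo F n (λ k → qbinom F q n k * (bernoulliDifference (n ∸ k) * H x k)))
          ≈⟨ qEGF-qbinomConvolution bernoulliDifference (H x) ⟩
        Hx ⊛ C
          ≈⟨ cancel-D (begin
            D ⊛ (Hx ⊛ C)                           ≈⟨ ⊛-leftComm D Hx C ⟩
            Hx ⊛ (D ⊛ C)                           ≈⟨ ⊛-congʳ Hx D⊛bernoulliDifference ⟩
            Hx ⊛ (t ⊛ (e 1# ⊖ constₛ F lam))       ≈⟨ ⊛-leftComm Hx t (e 1# ⊖ constₛ F lam) ⟩
            t ⊛ (Hx ⊛ (e 1# ⊖ constₛ F lam))       ≈⟨ ⊛-congʳ t (⊛-comm Hx (e 1# ⊖ constₛ F lam)) ⟩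
            t ⊛ ((e 1# ⊖ constₛ F lam) ⊛ Hx)       ≈⟨ ⊛-congʳ t (isFrobeniusEuler x) ⟩
            t ⊛ (constₛ F (1# - lam) ⊛ e x)        ≈⟨ ⊛-leftComm t (constₛ F (1# - lam)) (e x) ⟩
            constₛ F (1# - lam) ⊛ (t ⊛ e x)        ≈⟨ ⊛-congʳ (constₛ F (1# - lam)) (isBernoulli x) ⟨
            constₛ F (1# - lam) ⊛ (D ⊛ EGF (B x))  ≈⟨ ⊛-leftComm (constₛ F (1# - lam)) D (EGF (B x)) ⟩
            D ⊛ (constₛ F (1# - lam) ⊛ EGF (B x))  ∎) ⟩
        constₛ F (1# - lam) ⊛ EGF (B x) ∎
        where
        Hx = EGF (H x)
        C  = EGF bernoulliDifference

      qbinomSum-bernoulli-frobeniusEuler : ∀ x n →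
        sumTo F n (λ k → qbinom F q n k * (bernoulliDifference (n ∸ k) * H x k)) ≈ (1# - lam) * B x n
      qbinomSum-bernoulli-frobeniusEuler x = qEGF-injective
        (λ m → trans (qEGF-bernoulli-frobeniusEuler x m) (sym (qEGF-scale (1# - lam) (B x) m)))

theorem2p6 : ∀ {c ℓ} (F : Field c ℓ) → let open Field F in
    (q : Carrier) → (∀ n → ¬ (_^_ F q (suc n) ≈ 1#)) →
    (lam : Carrier) → ¬ (lam ≈ 1#) →
    (B : Carrier → ℕ → Carrier) → IsQBernoulli F q B →
    (H : Carrier → ℕ → Carrier) → IsQFrobeniusEuler F q lam H →
    ∀ (n : ℕ) (x : Carrier) →
    B x n ≈ ((1# - lam) ⁻¹) * sumTo F n (λ k →
    qbinom F q n k * ((B 1# (n ∸ k) - lam * B 0# (n ∸ k)) * H x k))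
theorem2p6 F q q^suc≉1 lam lam≉1 B isBernoulli H isFrobeniusEuler n x = begin
  B x n                                 ≈⟨ x⁻¹*[x*y]≈y F (B x n) 1-lam≉0 ⟨
  (1# - lam) ⁻¹ * ((1# - lam) * B x n)  ≈⟨ *-cong refl (qbinomSum-bernoulli-frobeniusEuler
                                               F q q^suc≉1 lam B isBernoulli H isFrobeniusEuler x n) ⟨
  (1# - lam) ⁻¹ * sumTo F n _           ∎
  where
  open Field F
  open SetoidReasoning setoid

  1-lam≉0 : ¬ 1# - lam ≈ 0#
  1-lam≉0 = x-y≉0 F (λ 1≈lam → lam≉1 (sym 1≈lam))
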